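{- Let $k,a,b,c,r$ be integers with $k\geq c>b>a\geq 1$ and $r\geq 1$. Let $\mathcal{R}_{a,b,c,k}$ be the set of partitions $\pi=(\pi_1,\ldots,\pi_m)$ such that every part is congruent to $a$, $b$ or $c$ modulo $k$, the parts congruent to $c$ modulo $k$ are distinct, and for $1\leq i<m$, if $\pi_i\equiv a\pmod k$ then $\pi_{i+1}$ is congruent to $a$ or $c$ modulo $k$. Let $\mathcal{R}_{a,b,c,k,r}$ be the set of partitions in $\mathcal{R}_{a,b,c,k}$ for which there is no index $i$ with $\pi_i,\ldots,\pi_{i+r-1}$ all congruent to $b$ modulo $k$. Then $\mathcal{R}_{a,b,c,k}$ and $\mathcal{R}_{a,b,c,k,r}$ are separable integer partition classes with modulus $k$.
   Context: Partitions are non-increasing finite sequences of positive integers. For a positive integer $k$, a separable integer partition class $\mathcal{P}$ with modulus $k$ is a set of partitions for which there is a subset $\mathcal{B}\subset\mathcal{P}$ (the basis) such that for each $m\geq 1$ the number of partitions in $\mathcal{B}$ with $m$ parts is finite, every partition in $\mathcal{P}$ with $m$ parts is uniquely of the form $(b_1+\pi_1,\ldots,b_m+\pi_m)$ where $(b_1,\ldots,b_m)\in\mathcal{B}$ and $(\pi_1,\ldots,\pi_m)$ is a non-increasing sequence of nonnegative integers each divisible by $k$, and all partitions of this form lie in $\mathcal{P}$. -}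

module Defs where

open import Data.Nat using (ℕ; _+_; _≤_; _<_; _≥_)
open import Data.Nat.Divisibility using (_∣_)
open import Data.Integer as ℤ using (+_)
import Data.Integer.Divisibility as ℤD
open import Data.List using (List; []; _∷_; length; zipWith; take; drop)
open import Data.List.Membership.Propositional using (_∈_)
open import Data.List.Relation.Unary.All using (All)
open import Data.List.Relation.Unary.Linked using (Linked)
open import Data.Fin using (Fin)
open import Data.List using (lookup)
open import Data.Product using (Σ; _×_; ∃)
open import Data.Sum using (_⊎_)
open import Relation.Nullary using (¬_)
open import Relation.Binary.PropositionalEquality using (_≡_; _≢_)

_≡_[mod_] : ℕ → ℕ → ℕ → Set
x ≡ y [mod k ] = (+ k) ℤD.∣ ((+ x) ℤ.- (+ y))

NonIncreasing : List ℕ → Set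
NonIncreasing = Linked _≥_

IsPartition : List ℕ → Set
IsPartition l = NonIncreasing l × All (λ x → 1 ≤ x) l

PartitionClass : Set₁
PartitionClass = List ℕ → Set

_⊕_ : List ℕ → List ℕ → List ℕ
b ⊕ π = zipWith _+_ b π

IsShift : ℕ → ℕ → List ℕ → Set
IsShift k m π = length π ≡ m × NonIncreasing π × All (λ x → k ∣ x) π

IsBasis : ℕ → PartitionClass → PartitionClass → Set
IsBasis k P B =
  (∀ b → B b → P b)
  × (∀ m → 1 ≤ m → Σ (List (List ℕ)) λ L → ∀ b → B b → length b ≡ m → b ∈ L)
  × (∀ λ' → P λ' → 1 ≤ length λ' →
       Σ (List ℕ) λ b → Σ (List ℕ) λ π →
         B b × length b ≡ length λ' × IsShift k (length λ') π × λ' ≡ b ⊕ π)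
  × (∀ m b π b' π' → 1 ≤ m →
       B b → length b ≡ m → IsShift k m π →
       B b' → length b' ≡ m → IsShift k m π' →
       b ⊕ π ≡ b' ⊕ π' → b ≡ b' × π ≡ π')
  × (∀ m b π → 1 ≤ m → B b → length b ≡ m → IsShift k m π → P (b ⊕ π))

SeparableClass : ℕ → PartitionClass → Set₁
SeparableClass k P = (∀ l → P l → IsPartition l) × Σ PartitionClass λ B → IsBasis k P B

AFollow : ℕ → ℕ → ℕ → ℕ → ℕ → Set
AFollow a c k x y = x ≡ a [mod k ] → (y ≡ a [mod k ] ⊎ y ≡ c [mod k ])

R : ℕ → ℕ → ℕ → ℕ → PartitionClass
R a b c k l =
  IsPartition l
  × All (λ x → x ≡ a [mod k ] ⊎ x ≡ b [mod k ] ⊎ x ≡ c [mod k ]) l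
  × (∀ (i j : Fin (length l)) → i ≢ j →
       lookup l i ≡ c [mod k ] → lookup l j ≡ c [mod k ] → lookup l i ≢ lookup l j)
  × Linked (AFollow a c k) l

-- 𝓡_{a,b,c,k,r}: no r consecutive parts (πᵢ,…,π_{i+r-1}) all ≡ b (mod k)
-- (index i is 0-based here: the block is take r (drop i l), requiring i + r ≤ m)
Rr : ℕ → ℕ → ℕ → ℕ → ℕ → PartitionClass
Rr a b c k r l =
  R a b c k l
  × (∀ i → i + r ≤ length l → ¬ All (λ x → x ≡ b [mod k ]) (take r (drop i l)))

{-# OPTIONS --safe #-}
module Submission where

-- Both classes consist of the partitions whose parts ≡ c (mod k) are distinct and which satisfy
-- a condition depending only on the residues of the parts.  Any such class is separable: the basis
-- partition of λ is obtained by lowering the parts of λ, from the smallest one upwards, to the least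
-- value in their residue class that is positive (for the smallest part) or at least the basis part
-- below it, and strictly larger if that part is ≡ c.  This reduction depends only on the residues
-- (whence uniqueness, and finitely many basis partitions of each length), and each part is lowered
-- at least as much as the part below it (whence the subtracted sequence is non-increasing).

open import Defs
import Algebra.Properties.CommutativeSemigroup as CommutativeSemigroupProperties
open import Data.Fin.Base using (Fin; zero; suc)
import Data.Fin.Properties as Fin
import Data.Integer.Base as ℤ
import Data.Integer.Properties as ℤᵖ
open import Data.List.Base
  using (List; []; _∷_; length; map; lookup; take; drop; zipWith; upTo; cartesianProductWith)
open import Data.List.Properties using (∷-injectiveˡ; ∷-injectiveʳ)
open import Data.List.Membership.Propositional using (_∈_)
open import Data.List.Membership.Propositional.Properties
  using (∈-map⁺; ∈-upTo⁺; ∈-cartesianProductWith⁺)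
open import Data.List.Relation.Binary.Pointwise as Pointwise
  using (Pointwise; []; _∷_; Pointwise-length; All-resp-Pointwise)
open import Data.List.Relation.Unary.All using (All; []; _∷_)
open import Data.List.Relation.Unary.Any using (here)
open import Data.List.Relation.Unary.Linked as Linked using (Linked; []; [-]; _∷_)
open import Data.Maybe.Relation.Binary.Connected using (just)
open import Data.Nat.Base
open import Data.Nat.DivMod
open import Data.Nat.Divisibility using (_∣_; divides; >⇒∤)
open import Data.Nat.Properties
open import Data.Product using (Σ; _×_; _,_; proj₁; proj₂)
open import Data.Sum as Sum using (_⊎_; inj₁; inj₂)
open import Function.Base using (_∘_)
open import Function.Bundles using (_⇔_; mk⇔; Equivalence)
open import Function.Properties.Equivalence using () renaming (trans to ⇔-trans; sym to ⇔-sym)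
open import Relation.Binary.Definitions using (Transitive; _Respects_)
open import Relation.Binary.PropositionalEquality
open import Relation.Nullary using (Dec; ¬_; contradiction; yes; no)
import Relation.Nullary.Decidable as Dec
open import Relation.Unary using (Decidable)

open CommutativeSemigroupProperties +-commutativeSemigroup using (x∙yz≈y∙xz)
open Equivalence using (to; from)

Pointwise-take : ∀ {A : Set} {R : A → A → Set} n {xs ys} →
  Pointwise R xs ys → Pointwise R (take n xs) (take n ys)
Pointwise-take zero    _        = []
Pointwise-take (suc n) []       = []
Pointwise-take (suc n) (r ∷ rs) = r ∷ Pointwise-take n rs

Pointwise-drop : ∀ {A : Set} {R : A → A → Set} n {xs ys} →
  Pointwise R xs ys → Pointwise R (drop n xs) (drop n ys)
Pointwise-drop zero    rs       = rs
Pointwise-drop (suc n) []       = []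
Pointwise-drop (suc n) (_ ∷ rs) = Pointwise-drop n rs

Linked-resp-Pointwise : ∀ {A : Set} {R S : A → A → Set} →
  (∀ {x x′ y y′} → R x x′ → R y y′ → S x y → S x′ y′) → Linked S Respects Pointwise R
Linked-resp-Pointwise resp []            []       = []
Linked-resp-Pointwise resp (_ ∷ [])      [-]      = [-]
Linked-resp-Pointwise resp (r ∷ r′ ∷ rs) (s ∷ ss) =
  resp r r′ s ∷ Linked-resp-Pointwise resp (r′ ∷ rs) ss

⊕-∸ : ∀ {b l} → Pointwise _≤_ b l → b ⊕ zipWith _∸_ l b ≡ l
⊕-∸ []          = refl
⊕-∸ (z≤x ∷ b≤l) = cong₂ _∷_ (m+[n∸m]≡n z≤x) (⊕-∸ b≤l)

length-∸ : ∀ {b l} → Pointwise _≤_ b l → length (zipWith _∸_ l b) ≡ length l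
length-∸ []        = refl
length-∸ (_ ∷ b≤l) = cong suc (length-∸ b≤l)

⊕-positive : ∀ {b} π → All (1 ≤_) b → All (1 ≤_) (b ⊕ π)
⊕-positive _       []                 = []
⊕-positive []      (_ ∷ _)            = []
⊕-positive (u ∷ π) (1≤x ∷ b-positive) = ≤-trans 1≤x (m≤m+n _ u) ∷ ⊕-positive π b-positive

⊕-cancelˡ : ∀ b {π π′} → length π ≡ length b → length π′ ≡ length b →
  b ⊕ π ≡ b ⊕ π′ → π ≡ π′
⊕-cancelˡ []      {[]}    {[]}     _  _   _ = refl
⊕-cancelˡ (x ∷ b) {u ∷ π} {u′ ∷ π′} lπ lπ′ e =
  cong₂ _∷_ (+-cancelˡ-≡ x u u′ (∷-injectiveˡ e))
            (⊕-cancelˡ b (suc-injective lπ) (suc-injective lπ′) (∷-injectiveʳ e))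

module Residues (k : ℕ) .{{_ : NonZero k}} where

  infix 4 _≈_
  _≈_ : ℕ → ℕ → Set
  x ≈ y = x % k ≡ y % k

  %-≈ : ∀ n → n % k ≈ n
  %-≈ n = m%n%n≡m%n n k

  +-cong-≈ : ∀ {x x′ y y′} → x ≈ x′ → y ≈ y′ → x + y ≈ x′ + y′
  +-cong-≈ {x} {x′} {y} {y′} x≈x′ y≈y′ = begin
    (x + y) % k           ≡⟨ %-distribˡ-+ x y k ⟩
    (x % k + y % k) % k   ≡⟨ cong₂ (λ u v → (u + v) % k) x≈x′ y≈y′ ⟩
    (x′ % k + y′ % k) % k ≡⟨ %-distribˡ-+ x′ y′ k ⟨
    (x′ + y′) % k         ∎
    where open ≡-Reasoning

  ≈⇔∣∸ : ∀ {x y} → y ≤ x → x ≈ y ⇔ k ∣ x ∸ y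
  ≈⇔∣∸ {x} {y} y≤x = mk⇔ ≈⇒∣∸ ∣∸⇒≈
    where
    ≈⇒∣∸ : x ≈ y → k ∣ x ∸ y
    ≈⇒∣∸ x≈y = divides (x / k ∸ y / k) (begin
      x ∸ y
        ≡⟨ cong₂ _∸_ (m≡m%n+[m/n]*n x k) (m≡m%n+[m/n]*n y k) ⟩
      (x % k + x / k * k) ∸ (y % k + y / k * k)
        ≡⟨ cong (λ r → (r + x / k * k) ∸ (y % k + y / k * k)) x≈y ⟩
      (y % k + x / k * k) ∸ (y % k + y / k * k)
        ≡⟨ [m+n]∸[m+o]≡n∸o (y % k) _ _ ⟩
      x / k * k ∸ y / k * k
        ≡⟨ *-distribʳ-∸ k (x / k) (y / k) ⟨
      (x / k ∸ y / k) * k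
        ∎)
      where open ≡-Reasoning
    ∣∸⇒≈ : k ∣ x ∸ y → x ≈ y
    ∣∸⇒≈ k∣x∸y = trans (cong (_% k) (sym (m+[n∸m]≡n y≤x))) (%-remove-+ʳ y k∣x∸y)

  ≡[mod]⇔∣∸ : ∀ {x y} → y ≤ x → x ≡ y [mod k ] ⇔ k ∣ x ∸ y
  ≡[mod]⇔∣∸ {x} {y} y≤x =
    mk⇔ (subst (k ∣_) ∣x-y∣≡x∸y) (subst (k ∣_) (sym ∣x-y∣≡x∸y))
    where
    open ≡-Reasoning
    ∣x-y∣≡x∸y : ℤ.∣ ℤ.+ x ℤ.- ℤ.+ y ∣ ≡ x ∸ y
    ∣x-y∣≡x∸y = begin
      ℤ.∣ ℤ.+ x ℤ.- ℤ.+ y ∣ ≡⟨ cong ℤ.∣_∣ (ℤᵖ.[+m]-[+n]≡m⊖n x y) ⟩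
      ℤ.∣ x ℤ.⊖ y ∣         ≡⟨ ℤᵖ.∣m⊖n∣≡∣n⊖m∣ x y ⟩
      ℤ.∣ y ℤ.⊖ x ∣         ≡⟨ ℤᵖ.∣⊖∣-≤ y≤x ⟩
      x ∸ y                 ∎

  ≡[mod]-sym : ∀ {x y} → x ≡ y [mod k ] → y ≡ x [mod k ]
  ≡[mod]-sym {x} {y} = subst (k ∣_) (ℤᵖ.∣i-j∣≡∣j-i∣ (ℤ.+ x) (ℤ.+ y))

  ≈⇔≡[mod] : ∀ {x y} → x ≈ y ⇔ x ≡ y [mod k ]
  ≈⇔≡[mod] {x} {y} with ≤-total y x
  ... | inj₁ y≤x = ⇔-trans (≈⇔∣∸ y≤x) (⇔-sym (≡[mod]⇔∣∸ y≤x))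
  ... | inj₂ x≤y =
    ⇔-trans (mk⇔ sym sym)
      (⇔-trans (≈⇔∣∸ x≤y)
        (⇔-trans (⇔-sym (≡[mod]⇔∣∸ x≤y))
          (mk⇔ (≡[mod]-sym {y}) (≡[mod]-sym {x}))))

  ≡[mod]? : ∀ x y → Dec (x ≡ y [mod k ])
  ≡[mod]? x y = Dec.map ≈⇔≡[mod] (x % k ≟ y % k)

  ≡[mod]-resp : ∀ {y} → (_≡ y [mod k ]) Respects _≈_
  ≡[mod]-resp {y} {x} {x′} x≈x′ x≡y =
    to (≈⇔≡[mod] {x′} {y}) (trans (sym x≈x′) (from (≈⇔≡[mod] {x} {y}) x≡y))

  ∣∧<⇒≡0 : ∀ {d} → k ∣ d → d < k → d ≡ 0
  ∣∧<⇒≡0 {zero}  _   _   = refl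
  ∣∧<⇒≡0 {suc d} k∣d d<k = contradiction k∣d (>⇒∤ d<k)

  ≈∧<⇒≡ : ∀ {u v} → u ≤ v → v < u + k → v ≈ u → u ≡ v
  ≈∧<⇒≡ {u} {v} u≤v v<u+k v≈u =
    ≤-antisym u≤v (m∸n≡0⇒m≤n (∣∧<⇒≡0 (to (≈⇔∣∸ u≤v) v≈u) v∸u<k))
    where
    v∸u<k : v ∸ u < k
    v∸u<k = +-cancelˡ-< u _ _ (subst (_< u + k) (sym (m+[n∸m]≡n u≤v)) v<u+k)

  -- h * pred k ≡ - h (mod k), so rep h x is the number in [h, h + k) congruent to x,
  -- computed without truncated subtraction.
  rep : ℕ → ℕ → ℕ
  rep h x = h + (x + h * pred k) % k

  rep-≈ : ∀ h x → rep h x ≈ x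
  rep-≈ h x = begin
    (h + (x + h * pred k) % k) % k ≡⟨ +-cong-≈ {h} refl (%-≈ (x + h * pred k)) ⟩
    (h + (x + h * pred k)) % k     ≡⟨ cong (_% k) (x∙yz≈y∙xz h x _) ⟩
    (x + (h + h * pred k)) % k     ≡⟨ cong (λ m → (x + m) % k) (*-suc h (pred k)) ⟨
    (x + h * suc (pred k)) % k     ≡⟨ cong (λ n → (x + h * n) % k) (suc-pred k) ⟩
    (x + h * k) % k                ≡⟨ [m+kn]%n≡m%n x h k ⟩
    x % k                          ∎
    where open ≡-Reasoning

  rep-cong : ∀ h {x x′} → x ≈ x′ → rep h x ≡ rep h x′
  rep-cong h x≈x′ = cong (h +_) (+-cong-≈ x≈x′ refl)

  rep-≥ : ∀ h x → h ≤ rep h x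
  rep-≥ h x = m≤m+n h _

  rep-< : ∀ h x → rep h x < h + k
  rep-< h x = +-monoʳ-< h (m%n<n _ k)

  rep-least : ∀ {h w} x → h ≤ w → w ≈ x → rep h x ≤ w
  rep-least {h} {w} x h≤w w≈x with ≤-total (rep h x) w
  ... | inj₁ rep≤w = rep≤w
  ... | inj₂ w≤rep = ≤-reflexive (sym (≈∧<⇒≡ w≤rep rep<w+k (trans (rep-≈ h x) (sym w≈x))))
    where
    rep<w+k : rep h x < w + k
    rep<w+k = <-≤-trans (rep-< h x) (+-monoˡ-≤ k h≤w)

  residueLists : ℕ → List (List ℕ)
  residueLists zero    = [] ∷ []
  residueLists (suc m) = cartesianProductWith _∷_ (upTo k) (residueLists m)

  ∈-residueLists : ∀ l → map (_% k) l ∈ residueLists (length l)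
  ∈-residueLists []      = here refl
  ∈-residueLists (x ∷ l) = ∈-cartesianProductWith⁺ _∷_ (∈-upTo⁺ (m%n<n x k)) (∈-residueLists l)

  map-%-≈ : ∀ l → Pointwise _≈_ (map (_% k) l) l
  map-%-≈ []      = []
  map-%-≈ (x ∷ l) = %-≈ x ∷ map-%-≈ l

  ⊕-≈ : ∀ {b π} → All (k ∣_) π → length π ≡ length b → Pointwise _≈_ (b ⊕ π) b
  ⊕-≈ {[]}    []          _ = []
  ⊕-≈ {x ∷ b} (k∣u ∷ k∣π) e = %-remove-+ʳ x k∣u ∷ ⊕-≈ k∣π (suc-injective e)

  ∸-divisible : ∀ {b l} → Pointwise _≤_ b l → Pointwise _≈_ b l → All (k ∣_) (zipWith _∸_ l b)
  ∸-divisible []          []          = []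
  ∸-divisible (z≤x ∷ b≤l) (z≈x ∷ b≈l) =
    to (≈⇔∣∸ z≤x) (sym z≈x) ∷ ∸-divisible b≤l b≈l

  module Separable {C : ℕ → Set} (C? : Decidable C) (C-resp : C Respects _≈_) where

    DistinctOn : List ℕ → Set
    DistinctOn l = ∀ (i j : Fin (length l)) → i ≢ j →
      C (lookup l i) → C (lookup l j) → lookup l i ≢ lookup l j

    infix 4 _≥ᶜ_
    _≥ᶜ_ : ℕ → ℕ → Set
    x ≥ᶜ y = y ≤ x × (C x → C y → x ≢ y)

    ≥ᶜ-trans : Transitive _≥ᶜ_
    ≥ᶜ-trans {x} {y} {z} (y≤x , x≢ᶜy) (z≤y , _) = ≤-trans z≤y y≤x , x≢ᶜz
      where
      x≢ᶜz : C x → C z → x ≢ z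
      x≢ᶜz Cx _ refl = x≢ᶜy Cx (subst C x≡y Cx) x≡y
        where
        x≡y : x ≡ y
        x≡y = ≤-antisym z≤y y≤x

    head-≥ᶜ : ∀ {x l} → Linked _≥ᶜ_ (x ∷ l) → ∀ i → x ≥ᶜ lookup l i
    head-≥ᶜ (r ∷ rs) = Linked.lookup ≥ᶜ-trans rs (just r)

    ≥ᶜ⇒distinct : ∀ {l} → Linked _≥ᶜ_ l → DistinctOn l
    ≥ᶜ⇒distinct {x ∷ l} ≥ᶜl zero    zero    i≢j = contradiction refl i≢j
    ≥ᶜ⇒distinct {x ∷ l} ≥ᶜl zero    (suc j) _   = proj₂ (head-≥ᶜ ≥ᶜl j)
    ≥ᶜ⇒distinct {x ∷ l} ≥ᶜl (suc i) zero    _   =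
      λ Ci Cx e → proj₂ (head-≥ᶜ ≥ᶜl i) Cx Ci (sym e)
    ≥ᶜ⇒distinct {x ∷ l} ≥ᶜl (suc i) (suc j) i≢j =
      ≥ᶜ⇒distinct (Linked.tail ≥ᶜl) i j (i≢j ∘ cong suc)

    distinct⇒≥ᶜ : ∀ {l} → NonIncreasing l → DistinctOn l → Linked _≥ᶜ_ l
    distinct⇒≥ᶜ []          _        = []
    distinct⇒≥ᶜ [-]         _        = [-]
    distinct⇒≥ᶜ (y≤x ∷ ≥l) distinct =
      (y≤x , distinct zero (suc zero) (λ ())) ∷
      distinct⇒≥ᶜ ≥l (λ i j i≢j → distinct (suc i) (suc j) (i≢j ∘ Fin.suc-injective))

    +-≥ᶜ : ∀ {x y u v} → x ≥ᶜ y → v ≤ u → k ∣ u → k ∣ v → x + u ≥ᶜ y + v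
    +-≥ᶜ {x} {y} {u} {v} (y≤x , x≢ᶜy) v≤u k∣u k∣v = +-mono-≤ y≤x v≤u , x+u≢ᶜy+v
      where
      x+u≢ᶜy+v : C (x + u) → C (y + v) → x + u ≢ y + v
      x+u≢ᶜy+v Cx+u Cy+v e =
        x≢ᶜy (C-resp (%-remove-+ʳ x k∣u) Cx+u) (C-resp (%-remove-+ʳ y k∣v) Cy+v)
          (≤-antisym (+-cancelʳ-≤ u x y (subst (_≤ y + u) (sym e) (+-monoʳ-≤ y v≤u))) y≤x)

    ⊕-≥ᶜ : ∀ {b π} → Linked _≥ᶜ_ b → NonIncreasing π → All (k ∣_) π →
      Linked _≥ᶜ_ (b ⊕ π)
    ⊕-≥ᶜ []           _          _                 = []
    ⊕-≥ᶜ [-]          []         _                 = []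
    ⊕-≥ᶜ [-]          [-]        _                 = [-]
    ⊕-≥ᶜ [-]          (_ ∷ _)    _                 = [-]
    ⊕-≥ᶜ (_ ∷ _)      []         _                 = []
    ⊕-≥ᶜ (_ ∷ _)      [-]        _                 = [-]
    ⊕-≥ᶜ (x≥ᶜy ∷ ≥ᶜb) (v≤u ∷ ≥π) (k∣u ∷ k∣v ∷ k∣π) =
      +-≥ᶜ x≥ᶜy v≤u k∣u k∣v ∷ ⊕-≥ᶜ ≥ᶜb ≥π (k∣v ∷ k∣π)

    minAbove : ℕ → ℕ
    minAbove h with C? h
    ... | yes _ = suc h
    ... | no  _ = h

    ≤-minAbove : ∀ h → h ≤ minAbove h
    ≤-minAbove h with C? h
    ... | yes _ = n≤1+n h
    ... | no  _ = ≤-refl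

    minAbove-≤ : ∀ {h w} → h ≤ w → (C h → w ≢ h) → minAbove h ≤ w
    minAbove-≤ {h} h≤w w≢h with C? h
    ... | yes Ch = ≤∧≢⇒< h≤w (w≢h Ch ∘ sym)
    ... | no  _  = h≤w

    minAbove-≥ᶜ : ∀ {h z} → minAbove h ≤ z → z ≥ᶜ h
    minAbove-≥ᶜ {h} min≤z with C? h
    ... | yes _   = <⇒≤ min≤z , λ _ _ z≡h → <⇒≢ min≤z (sym z≡h)
    ... | no  ¬Ch = min≤z , λ _ Ch _ → ¬Ch Ch

    minOnTop : List ℕ → ℕ
    minOnTop []      = 1
    minOnTop (h ∷ _) = minAbove h

    minOnTop-positive : ∀ {b} → All (1 ≤_) b → 1 ≤ minOnTop b
    minOnTop-positive []                = ≤-refl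
    minOnTop-positive {h ∷ _} (1≤h ∷ _) = ≤-trans 1≤h (≤-minAbove h)

    reduce : List ℕ → List ℕ
    reduce []      = []
    reduce (x ∷ l) = rep (minOnTop (reduce l)) x ∷ reduce l

    reduce-≈ : ∀ l → Pointwise _≈_ (reduce l) l
    reduce-≈ []      = []
    reduce-≈ (x ∷ l) = rep-≈ _ x ∷ reduce-≈ l

    reduce-cong : ∀ {l l′} → Pointwise _≈_ l l′ → reduce l ≡ reduce l′
    reduce-cong []                    = refl
    reduce-cong {x ∷ l} (x≈x′ ∷ l≈l′) = cong₂ _∷_
      (trans (cong (λ r → rep (minOnTop r) x) (reduce-cong l≈l′)) (rep-cong _ x≈x′))
      (reduce-cong l≈l′)

    reduce-≥ᶜ : ∀ l → Linked _≥ᶜ_ (reduce l)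
    reduce-≥ᶜ []      = []
    reduce-≥ᶜ (x ∷ l) with reduce l | reduce-≥ᶜ l
    ... | []    | _    = [-]
    ... | h ∷ _ | ≥ᶜr = minAbove-≥ᶜ (rep-≥ (minAbove h) x) ∷ ≥ᶜr

    reduce-positive : ∀ l → All (1 ≤_) (reduce l)
    reduce-positive []      = []
    reduce-positive (x ∷ l) =
      ≤-trans (minOnTop-positive (reduce-positive l)) (rep-≥ _ x) ∷ reduce-positive l

    lowering-≤ : ∀ {h x y} → h ≤ y → h ≈ y → x ≥ᶜ y →
      rep (minAbove h) x ≤ x × y ∸ h ≤ x ∸ rep (minAbove h) x
    lowering-≤ {h} {x} {y} h≤y h≈y (y≤x , x≢ᶜy) =
      m+n≤o⇒n≤o d d+z≤x , m+n≤o⇒m≤o∸n d d+z≤x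
      where
      d w : ℕ
      d = y ∸ h
      w = x ∸ d
      d+w≡x : d + w ≡ x
      d+w≡x = m+[n∸m]≡n (≤-trans (m∸n≤m y h) y≤x)
      w≈x : w ≈ x
      w≈x = trans (sym (%-remove-+ˡ w (to (≈⇔∣∸ h≤y) (sym h≈y)))) (cong (_% k) d+w≡x)
      h≤w : h ≤ w
      h≤w = subst (_≤ w) (m∸[m∸n]≡n h≤y) (∸-monoˡ-≤ d y≤x)
      w≢h : C h → w ≢ h
      w≢h Ch w≡h = x≢ᶜy (subst C (sym x≡y) Cy) Cy x≡y
        where
        Cy : C y
        Cy = C-resp h≈y Ch
        x≡y : x ≡ y
        x≡y = trans (sym d+w≡x) (trans (cong (d +_) w≡h) (m∸n+n≡m h≤y))
      d+z≤x : d + rep (minAbove h) x ≤ x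
      d+z≤x = subst (d + rep (minAbove h) x ≤_) d+w≡x
        (+-monoʳ-≤ d (rep-least x (minAbove-≤ h≤w w≢h) w≈x))

    reduce-≤ : ∀ {l} → Linked _≥ᶜ_ l → All (1 ≤_) l → Pointwise _≤_ (reduce l) l
    reduce-≤ []           []         = []
    reduce-≤ {x ∷ []} [-] (1≤x ∷ []) = rep-least x 1≤x refl ∷ []
    reduce-≤ {x ∷ y ∷ l} (x≥ᶜy ∷ ≥ᶜl) (_ ∷ l-positive) =
      proj₁ (lowering-≤ (Pointwise.head r≤l) (rep-≈ (minOnTop (reduce l)) y) x≥ᶜy) ∷ r≤l
      where
      r≤l : Pointwise _≤_ (reduce (y ∷ l)) (y ∷ l)
      r≤l = reduce-≤ ≥ᶜl l-positive

    shift-nonIncreasing : ∀ {l} → Linked _≥ᶜ_ l → All (1 ≤_) l →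
      NonIncreasing (zipWith _∸_ l (reduce l))
    shift-nonIncreasing [-] _ = [-]
    shift-nonIncreasing []  _ = []
    shift-nonIncreasing {x ∷ y ∷ l} (x≥ᶜy ∷ ≥ᶜl) (_ ∷ l-positive) =
      proj₂ (lowering-≤ (Pointwise.head r≤l) (rep-≈ (minOnTop (reduce l)) y) x≥ᶜy) ∷
      shift-nonIncreasing ≥ᶜl l-positive
      where
      r≤l : Pointwise _≤_ (reduce (y ∷ l)) (y ∷ l)
      r≤l = reduce-≤ ≥ᶜl l-positive

    Class : (List ℕ → Set) → List ℕ → Set
    Class Q l = IsPartition l × DistinctOn l × Q l

    Basis : (List ℕ → Set) → List ℕ → Set
    Basis Q b = Class Q b × reduce b ≡ b

    module _ {Q : List ℕ → Set} (Q-resp : Q Respects Pointwise _≈_) where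

      ≥ᶜ-class : ∀ {l} → Linked _≥ᶜ_ l → All (1 ≤_) l → Q l → Class Q l
      ≥ᶜ-class ≥ᶜl l-positive q = (Linked.map proj₁ ≥ᶜl , l-positive) , ≥ᶜ⇒distinct ≥ᶜl , q

      class-≥ᶜ : ∀ {l} → Class Q l → Linked _≥ᶜ_ l
      class-≥ᶜ ((≥l , _) , distinct , _) = distinct⇒≥ᶜ ≥l distinct

      reduce-basis : ∀ {l} → Class Q l → Basis Q (reduce l)
      reduce-basis {l} (_ , _ , q) =
        ≥ᶜ-class (reduce-≥ᶜ l) (reduce-positive l) (Q-resp (Pointwise.symmetric sym (reduce-≈ l)) q) ,
        reduce-cong (reduce-≈ l)

      basis-finite : ∀ m → Σ (List (List ℕ)) λ L → ∀ b → Basis Q b → length b ≡ m → b ∈ L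
      basis-finite m = map reduce (residueLists m) , λ b (_ , b-reduced) lb →
        subst (λ n → b ∈ map reduce (residueLists n)) lb
          (subst (_∈ map reduce (residueLists (length b))) (trans (reduce-cong (map-%-≈ b)) b-reduced)
            (∈-map⁺ reduce (∈-residueLists b)))

      decompose : ∀ l → Class Q l →
        Σ (List ℕ) λ b → Σ (List ℕ) λ π →
          Basis Q b × length b ≡ length l × IsShift k (length l) π × l ≡ b ⊕ π
      decompose l l∈Q =
        reduce l , zipWith _∸_ l (reduce l) , reduce-basis l∈Q , Pointwise-length (reduce-≈ l) ,
        (length-∸ r≤l , shift-nonIncreasing ≥ᶜl l-positive , ∸-divisible r≤l (reduce-≈ l)) ,
        sym (⊕-∸ r≤l)
        where
        ≥ᶜl : Linked _≥ᶜ_ l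
        ≥ᶜl = class-≥ᶜ l∈Q
        l-positive : All (1 ≤_) l
        l-positive = proj₂ (proj₁ l∈Q)
        r≤l : Pointwise _≤_ (reduce l) l
        r≤l = reduce-≤ ≥ᶜl l-positive

      decompose-unique : ∀ m b π b′ π′ →
        Basis Q b → length b ≡ m → IsShift k m π →
        Basis Q b′ → length b′ ≡ m → IsShift k m π′ →
        b ⊕ π ≡ b′ ⊕ π′ → b ≡ b′ × π ≡ π′
      decompose-unique m b π b′ π′
        (_ , b-reduced) lb (lπ , _ , k∣π) (_ , b′-reduced) lb′ (lπ′ , _ , k∣π′) e =
        b≡b′ , ⊕-cancelˡ b lπ≡lb lπ′≡lb (trans e (cong (_⊕ π′) (sym b≡b′)))
        where
        open ≡-Reasoning
        lπ≡lb : length π ≡ length b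
        lπ≡lb = trans lπ (sym lb)
        lπ′≡lb : length π′ ≡ length b
        lπ′≡lb = trans lπ′ (sym lb)
        b≡b′ : b ≡ b′
        b≡b′ = begin
          b                ≡⟨ b-reduced ⟨
          reduce b         ≡⟨ reduce-cong (⊕-≈ k∣π lπ≡lb) ⟨
          reduce (b ⊕ π)   ≡⟨ cong reduce e ⟩
          reduce (b′ ⊕ π′) ≡⟨ reduce-cong (⊕-≈ k∣π′ (trans lπ′ (sym lb′))) ⟩
          reduce b′        ≡⟨ b′-reduced ⟩
          b′               ∎

      basis-⊕-closed : ∀ m b π → Basis Q b → length b ≡ m → IsShift k m π → Class Q (b ⊕ π)
      basis-⊕-closed m b π (b∈Q@((_ , b-positive) , _ , q) , _) lb (lπ , ≥π , k∣π) =
        ≥ᶜ-class (⊕-≥ᶜ (class-≥ᶜ b∈Q) ≥π k∣π) (⊕-positive π b-positive)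
          (Q-resp (Pointwise.symmetric sym (⊕-≈ k∣π (trans lπ (sym lb)))) q)

      separable : SeparableClass k (Class Q)
      separable =
        (λ _ → proj₁) , Basis Q , (λ _ → proj₁) , (λ m _ → basis-finite m) ,
        (λ l l∈Q _ → decompose l l∈Q) , (λ m b π b′ π′ _ → decompose-unique m b π b′ π′) ,
        (λ m b π _ → basis-⊕-closed m b π)

SeparableClass-resp-⇔ : ∀ {k P P′} → (∀ l → P l ⇔ P′ l) →
  SeparableClass k P → SeparableClass k P′
SeparableClass-resp-⇔ P⇔P′ (partition , B , B⊆P , finite , decompose , unique , closed) =
  (λ l → partition l ∘ from (P⇔P′ l)) , B , (λ b → to (P⇔P′ b) ∘ B⊆P b) , finite ,
  (λ l → decompose l ∘ from (P⇔P′ l)) , unique ,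
  (λ m b π 1≤m Bb lb π-shift → to (P⇔P′ _) (closed m b π 1≤m Bb lb π-shift))

module _ (k a b c r : ℕ) .{{_ : NonZero k}} where
  open Residues k
  open Separable {C = _≡ c [mod k ]} (λ x → ≡[mod]? x c) (≡[mod]-resp {c})

  Allowed : ℕ → Set
  Allowed x = x ≡ a [mod k ] ⊎ x ≡ b [mod k ] ⊎ x ≡ c [mod k ]

  Allowed-resp : Allowed Respects _≈_
  Allowed-resp {x} {x′} x≈x′ = Sum.map (transfer a) (Sum.map (transfer b) (transfer c))
    where
    transfer : ∀ y → x ≡ y [mod k ] → x′ ≡ y [mod k ]
    transfer y = ≡[mod]-resp {y} {x} {x′} x≈x′

  AFollow-resp : ∀ {x x′ y y′} → x ≈ x′ → y ≈ y′ → AFollow a c k x y → AFollow a c k x′ y′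
  AFollow-resp {x} {x′} {y} {y′} x≈x′ y≈y′ follow x′≡a =
    Sum.map (transfer a) (transfer c) (follow (≡[mod]-resp {a} {x′} {x} (sym x≈x′) x′≡a))
    where
    transfer : ∀ z → y ≡ z [mod k ] → y′ ≡ z [mod k ]
    transfer z = ≡[mod]-resp {z} {y} {y′} y≈y′

  ResidueConditions : List ℕ → Set
  ResidueConditions l = All Allowed l × Linked (AFollow a c k) l

  ResidueConditions-resp : ResidueConditions Respects Pointwise _≈_
  ResidueConditions-resp l≈l′ (allowed , follow) =
    All-resp-Pointwise Allowed-resp l≈l′ allowed , Linked-resp-Pointwise AFollow-resp l≈l′ follow

  NoRun : List ℕ → Set
  NoRun l = ∀ i → i + r ≤ length l → ¬ All (_≡ b [mod k ]) (take r (drop i l))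

  NoRun-resp : NoRun Respects Pointwise _≈_
  NoRun-resp {l} {l′} l≈l′ noRun i i+r≤ run =
    noRun i (subst (i + r ≤_) (sym (Pointwise-length l≈l′)) i+r≤)
      (All-resp-Pointwise (≡[mod]-resp {b}) (Pointwise-take r (Pointwise-drop i l′≈l)) run)
    where
    l′≈l : Pointwise _≈_ l′ l
    l′≈l = Pointwise.symmetric sym l≈l′

  R-separable : SeparableClass k (R a b c k)
  R-separable = SeparableClass-resp-⇔
    (λ _ → mk⇔ (λ (partition , distinct , allowed , follow) → partition , allowed , distinct , follow)
               (λ (partition , allowed , distinct , follow) → partition , distinct , allowed , follow))
    (separable ResidueConditions-resp)

  Rr-separable : SeparableClass k (Rr a b c k r)
  Rr-separable = SeparableClass-resp-⇔
    (λ _ → mk⇔ (λ (partition , distinct , (allowed , follow) , noRun) →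
                    (partition , allowed , distinct , follow) , noRun)
               (λ ((partition , allowed , distinct , follow) , noRun) →
                    partition , distinct , (allowed , follow) , noRun))
    (separable (λ l≈l′ (q , nr) → ResidueConditions-resp l≈l′ q , NoRun-resp l≈l′ nr))

theorem4p2 : (k a b c r : ℕ) → 1 ≤ a → a < b → b < c → c ≤ k → 1 ≤ r →
    SeparableClass k (R a b c k) × SeparableClass k (Rr a b c k r)
theorem4p2 zero      _ _ _ _ _ _ () z≤n _
theorem4p2 k@(suc _) a b c r _ _ _ _ _ = R-separable k a b c r , Rr-separable k a b c r
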